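{- Let $\mathbf{v}_1,\ldots,\mathbf{v}_k\in\mathbb{Z}^d$, let $\mathbf{L}$ be the lattice $\mathbb{Z}\mathbf{v}_1+\cdots+\mathbb{Z}\mathbf{v}_k$, and let $L$ be the $d\times k$ integer matrix whose $j$-th column is $\mathbf{v}_j$. Let $r$ be the rank of $L$ and assume that $L$ decomposes into blocks $$L=\begin{bmatrix}A & A'\\ B & B'\end{bmatrix}$$ where $A$ is a non-singular $r\times r$ matrix, $B$ is $(d-r)\times r$, $A'$ is $r\times(k-r)$ and $B'$ is $(d-r)\times(k-r)$. Let $M=[A\,A']$ (a full row rank $r\times k$ integer matrix) and let $U$ be the unimodular matrix such that $MU=[H\,0]$ is the Hermite normal form of $M$. Then $\mathbf{L}$ is exactly the set of vectors $\mathbf{x}\in\mathbb{Z}^d$ such that: (i) $\det(H)$ divides every coefficient of the row vector $[\mathbf{x}(1)\ldots\mathbf{x}(r)]\operatorname{com}(H)$, and (ii) $\det(A)\,[\mathbf{x}(r+1)\ldots\mathbf{x}(d)]=[\mathbf{x}(1)\ldots\mathbf{x}(r)]\operatorname{com}(A)B^\top$.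
   Context: For an $r\times r$ matrix $N$, $\operatorname{com}(N)$ denotes the $r\times r$ matrix with $(\operatorname{com}(N))_{ij}=\det(N^{ij})$, where $N^{ij}$ is obtained from $N$ by replacing its $j$-th column by the $i$-th unit column vector (zeros except a one on row $i$); thus $N^\top\operatorname{com}(N)=\det(N)I_r$. A matrix $U$ is unimodular if it is an integer square matrix with determinant $\pm1$. For a full row rank $r\times k$ integer matrix $M$, its Hermite normal form is $[H\,0]=MU$ with $U$ unimodular and $H$ a non-singular, lower triangular, non-negative $r\times r$ matrix in which each row has a unique maximum entry, located on the main diagonal; $H$ and $U$ are unique. $B^\top$ is the transpose of $B$. -}

module Defs where

open import Data.Nat using (ℕ; zero; suc; _+_)
open import Data.Fin using (Fin; zero; suc; toℕ; punchIn; _↑ˡ_; _↑ʳ_; _<_)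
open import Data.Integer using (ℤ; 0ℤ; 1ℤ; -_; -1ℤ) renaming (_+_ to _+ℤ_; _*_ to _*ℤ_; _≤_ to _≤ℤ_; _<_ to _<ℤ_)
open import Data.Integer.Divisibility using (_∣_)
open import Data.Product using (Σ; ∃; _×_)
open import Data.Sum using (_⊎_)
open import Relation.Binary.PropositionalEquality using (_≡_; _≢_)
open import Relation.Nullary using (¬_)
open import Function.Definitions using (Injective)

Mat : ℕ → ℕ → Set
Mat m n = Fin m → Fin n → ℤ

sumFin : ∀ {n} → (Fin n → ℤ) → ℤ
sumFin {zero}  f = 0ℤ
sumFin {suc n} f = f zero +ℤ sumFin (λ i → f (suc i))

signed : ℕ → ℤ → ℤ
signed zero    z = z
signed (suc n) z = - signed n z

det : ∀ {n} → Mat n n → ℤ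
det {zero}  M = 1ℤ
det {suc n} M = sumFin (λ j → signed (toℕ j) (M zero j *ℤ det (λ a b → M (suc a) (punchIn j b))))

_⊗_ : ∀ {m n p} → Mat m n → Mat n p → Mat m p
(M ⊗ N) a b = sumFin (λ l → M a l *ℤ N l b)

transpose : ∀ {m n} → Mat m n → Mat n m
transpose M a b = M b a

unit : ∀ {n} → Fin n → Fin n → ℤ
unit i a with Data.Fin._≟_ a i
... | Relation.Nullary.yes _ = 1ℤ
... | Relation.Nullary.no  _ = 0ℤ

replaceCol : ∀ {n} → Mat n n → Fin n → Fin n → Mat n n
replaceCol N i j a b with Data.Fin._≟_ b j
... | Relation.Nullary.yes _ = unit i a
... | Relation.Nullary.no  _ = N a b

com : ∀ {n} → Mat n n → Mat n n
com N i j = det (replaceCol N i j)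

Unimodular : ∀ {n} → Mat n n → Set
Unimodular U = det U ≡ 1ℤ ⊎ det U ≡ -1ℤ

submatrix : ∀ {m n p q} → Mat m n → (Fin p → Fin m) → (Fin q → Fin n) → Mat p q
submatrix M ρ κ a b = M (ρ a) (κ b)

HasRank : ∀ {m n} → Mat m n → ℕ → Set
HasRank {m} {n} M r =
  (∃ λ (ρ : Fin r → Fin m) → ∃ λ (κ : Fin r → Fin n) →
     Injective _≡_ _≡_ ρ × Injective _≡_ _≡_ κ × det (submatrix M ρ κ) ≢ 0ℤ)
  × ((ρ : Fin (suc r) → Fin m) (κ : Fin (suc r) → Fin n) →
     Injective _≡_ _≡_ ρ → Injective _≡_ _≡_ κ → det (submatrix M ρ κ) ≡ 0ℤ)

IsHNF : ∀ {r t} → Mat r (r + t) → Mat r r → Mat (r + t) (r + t) → Set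
IsHNF {r} {t} M H U =
  Unimodular U
  × (∀ a b → (M ⊗ U) a (b ↑ˡ t) ≡ H a b)
  × (∀ a b → (M ⊗ U) a (r ↑ʳ b) ≡ 0ℤ)
  × det H ≢ 0ℤ
  × (∀ a b → a < b → H a b ≡ 0ℤ)
  × (∀ a b → 0ℤ ≤ℤ H a b)
  × (∀ a b → a ≢ b → H a b <ℤ H a a)

InLattice : ∀ {d k} → Mat d k → (Fin d → ℤ) → Set
InLattice {d} {k} L x = ∃ λ (c : Fin k → ℤ) → ∀ i → x i ≡ sumFin (λ j → L i j *ℤ c j)

-- Write x = (x′, x″) with x′ the first r coordinates.  As det A ≠ 0 while every
-- (r+1)-minor of L vanishes, the Schur complement formula for the bordered minors
-- with rows (r+p, 1..r) and columns (q, 1..r) gives det A · L(r+p, q) = Σᵢ L(i, q) (com A Bᵀ)ᵢₚ: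
-- the bottom rows of L are combinations of the top rows.  So (ii) holds on the lattice
-- and, conversely, determines x″ from x′.  The top parts of lattice vectors form the
-- column lattice of M = [A A′], which is H ℤʳ because U is unimodular, and x′ ∈ H ℤʳ
-- iff det H divides every entry of x′ᵀ com H, by the adjugate identities
-- Hᵀ com H = com H Hᵀ = det H · I.

module Submission where

open import Defs
open import Data.Nat using (ℕ; zero; suc; _+_)
open import Data.Fin using (Fin; zero; suc; punchIn; toℕ; _↑ˡ_; _↑ʳ_; splitAt; _≟_)
open import Data.Fin.Properties using (suc-injective; ↑ˡ-injective; splitAt-↑ˡ; splitAt-↑ʳ)
open import Data.Integer using (ℤ; +_; -[1+_]; 0ℤ; 1ℤ; -_; _-_; ≢-nonZero)
  renaming (_+_ to _+ℤ_; _*_ to _*ℤ_)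
open import Data.Integer.Properties as ℤ using (+-*-semiring)
open import Data.Integer.Tactic.RingSolver using (solve-∀)
open import Data.Integer.Divisibility using (_∣_)
open import Data.Integer.Divisibility.Signed as Signed using (∣⇒∣ᵤ; ∣ᵤ⇒∣)
open import Data.Vec.Functional using (updateAt; _∷_; _++_)
open import Data.Vec.Functional.Properties
  using (updateAt-updates; updateAt-minimal; updateAt-id-local; lookup-++ˡ)
open import Data.Product using (∃; _×_; _,_; proj₁; proj₂)
open import Data.Sum using ([_,_]′)
open import Function using (_∘_; const)
open import Function.Bundles using (_⇔_; mk⇔)
open import Function.Definitions using (Injective)
open import Relation.Binary.PropositionalEquality
  using (_≡_; _≢_; refl; sym; trans; cong; cong₂; cong-app; module ≡-Reasoning)
open import Relation.Nullary using (yes; no; contradiction)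
open import Algebra.Properties.CommutativeSemigroup ℤ.*-commutativeSemigroup using (x∙yz≈y∙xz)
open import Algebra.Properties.Semiring.Sum +-*-semiring
  using (sum; ∑-comm; *-distribˡ-sum; *-distribʳ-sum)

-- Finite sums and matrix–vector products

sumFin≡sum : ∀ {n} (f : Fin n → ℤ) → sumFin f ≡ sum f
sumFin≡sum {zero}  f = refl
sumFin≡sum {suc n} f = cong (f zero +ℤ_) (sumFin≡sum (f ∘ suc))

sumFin-cong : ∀ {n} {f g : Fin n → ℤ} → (∀ i → f i ≡ g i) → sumFin f ≡ sumFin g
sumFin-cong {zero}  f≗g = refl
sumFin-cong {suc n} f≗g = cong₂ _+ℤ_ (f≗g zero) (sumFin-cong (f≗g ∘ suc))

*-distribˡ-sumFin : ∀ {n} x (f : Fin n → ℤ) → x *ℤ sumFin f ≡ sumFin (λ i → x *ℤ f i)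
*-distribˡ-sumFin x f = begin
  x *ℤ sumFin f             ≡⟨ cong (x *ℤ_) (sumFin≡sum f) ⟩
  x *ℤ sum f                ≡⟨ *-distribˡ-sum x f ⟩
  sum (λ i → x *ℤ f i)      ≡⟨ sumFin≡sum (λ i → x *ℤ f i) ⟨
  sumFin (λ i → x *ℤ f i)   ∎
  where open ≡-Reasoning

*-distribʳ-sumFin : ∀ {n} x (f : Fin n → ℤ) → sumFin f *ℤ x ≡ sumFin (λ i → f i *ℤ x)
*-distribʳ-sumFin x f = begin
  sumFin f *ℤ x             ≡⟨ cong (_*ℤ x) (sumFin≡sum f) ⟩
  sum f *ℤ x                ≡⟨ *-distribʳ-sum x f ⟩
  sum (λ i → f i *ℤ x)      ≡⟨ sumFin≡sum (λ i → f i *ℤ x) ⟨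
  sumFin (λ i → f i *ℤ x)   ∎
  where open ≡-Reasoning

sumFin-comm : ∀ {m n} (f : Fin m → Fin n → ℤ) →
  sumFin (λ i → sumFin (f i)) ≡ sumFin (λ j → sumFin (λ i → f i j))
sumFin-comm f = begin
  sumFin (λ i → sumFin (f i))           ≡⟨ sumFin-cong (λ i → sumFin≡sum (f i)) ⟩
  sumFin (λ i → sum (f i))              ≡⟨ sumFin≡sum (λ i → sum (f i)) ⟩
  sum (λ i → sum (f i))                 ≡⟨ ∑-comm f ⟩
  sum (λ j → sum (λ i → f i j))         ≡⟨ sumFin≡sum (λ j → sum (λ i → f i j)) ⟨
  sumFin (λ j → sum (λ i → f i j))      ≡⟨ sumFin-cong (λ j → sumFin≡sum (λ i → f i j)) ⟨
  sumFin (λ j → sumFin (λ i → f i j))   ∎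
  where open ≡-Reasoning

-‿distrib-sumFin : ∀ {n} (f : Fin n → ℤ) → - sumFin f ≡ sumFin (λ i → - f i)
-‿distrib-sumFin {zero}  f = refl
-‿distrib-sumFin {suc n} f = trans (ℤ.neg-distrib-+ (f zero) (sumFin (f ∘ suc)))
                                   (cong (- f zero +ℤ_) (-‿distrib-sumFin (f ∘ suc)))

sumFin-zero : ∀ {n} (f : Fin n → ℤ) → (∀ i → f i ≡ 0ℤ) → sumFin f ≡ 0ℤ
sumFin-zero {zero}  f f≗0 = refl
sumFin-zero {suc n} f f≗0 = cong₂ _+ℤ_ (f≗0 zero) (sumFin-zero (f ∘ suc) (f≗0 ∘ suc))

sumFin-single : ∀ {n} (f : Fin n → ℤ) k → (∀ i → i ≢ k → f i ≡ 0ℤ) → sumFin f ≡ f k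
sumFin-single f zero f≗0 =
  trans (cong (f zero +ℤ_) (sumFin-zero (f ∘ suc) (λ i → f≗0 (suc i) (λ ())))) (ℤ.+-identityʳ _)
sumFin-single f (suc k) f≗0 =
  trans (cong₂ _+ℤ_ (f≗0 zero (λ ()))
                    (sumFin-single (f ∘ suc) k (λ i i≢k → f≗0 (suc i) (i≢k ∘ suc-injective))))
        (ℤ.+-identityˡ _)

sumFin-↑ : ∀ m {n} (f : Fin (m + n) → ℤ) →
  sumFin f ≡ sumFin (λ i → f (i ↑ˡ n)) +ℤ sumFin (λ j → f (m ↑ʳ j))
sumFin-↑ zero    f = sym (ℤ.+-identityˡ _)
sumFin-↑ (suc m) f = trans (cong (f zero +ℤ_) (sumFin-↑ m (f ∘ suc))) (sym (ℤ.+-assoc (f zero) _ _))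

infixl 7 _*ᵥ_ _ᵥ*_

_*ᵥ_ : ∀ {m n} → Mat m n → (Fin n → ℤ) → Fin m → ℤ
(N *ᵥ v) a = sumFin (λ b → N a b *ℤ v b)

_ᵥ*_ : ∀ {m n} → (Fin m → ℤ) → Mat m n → Fin n → ℤ
(v ᵥ* N) b = sumFin (λ a → v a *ℤ N a b)

ᵥ*-*ᵥ-assoc : ∀ {m n} (u : Fin m → ℤ) (N : Mat m n) (v : Fin n → ℤ) →
  sumFin (λ a → u a *ℤ (N *ᵥ v) a) ≡ sumFin (λ b → (u ᵥ* N) b *ℤ v b)
ᵥ*-*ᵥ-assoc u N v = begin
  sumFin (λ a → u a *ℤ (N *ᵥ v) a)
    ≡⟨ sumFin-cong (λ a → *-distribˡ-sumFin (u a) (λ b → N a b *ℤ v b)) ⟩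
  sumFin (λ a → sumFin (λ b → u a *ℤ (N a b *ℤ v b)))
    ≡⟨ sumFin-comm (λ a b → u a *ℤ (N a b *ℤ v b)) ⟩
  sumFin (λ b → sumFin (λ a → u a *ℤ (N a b *ℤ v b)))
    ≡⟨ sumFin-cong (λ b → trans (sumFin-cong (λ a → sym (ℤ.*-assoc (u a) (N a b) (v b))))
                                (sym (*-distribʳ-sumFin (v b) (λ a → u a *ℤ N a b)))) ⟩
  sumFin (λ b → (u ᵥ* N) b *ℤ v b) ∎
  where open ≡-Reasoning

*ᵥ-*ʳ : ∀ {m n} (N : Mat m n) v e a → (N *ᵥ (λ b → v b *ℤ e)) a ≡ (N *ᵥ v) a *ℤ e
*ᵥ-*ʳ N v e a = trans (sumFin-cong (λ b → sym (ℤ.*-assoc (N a b) (v b) e)))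
                      (sym (*-distribʳ-sumFin e (λ b → N a b *ℤ v b)))

-- Laplace expansion and alternation

signed-distribʳ-* : ∀ k x z → signed k (x *ℤ z) ≡ x *ℤ signed k z
signed-distribʳ-* zero    x z = refl
signed-distribʳ-* (suc k) x z = trans (cong -_ (signed-distribʳ-* k x z)) (ℤ.neg-distribʳ-* x (signed k z))

signed-distrib-sumFin : ∀ {n} k (f : Fin n → ℤ) → signed k (sumFin f) ≡ sumFin (λ i → signed k (f i))
signed-distrib-sumFin zero    f = refl
signed-distrib-sumFin (suc k) f =
  trans (cong -_ (signed-distrib-sumFin k f)) (-‿distrib-sumFin (λ i → signed k (f i)))

signed-neg : ∀ k z → signed k (- z) ≡ - signed k z
signed-neg zero    z = refl
signed-neg (suc k) z = cong -_ (signed-neg k z)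

signed-comm : ∀ k l z → signed k (signed l z) ≡ signed l (signed k z)
signed-comm zero    l z = refl
signed-comm (suc k) l z = trans (cong -_ (signed-comm k l z)) (sym (signed-neg l (signed k z)))

signed-zero : ∀ k → signed k 0ℤ ≡ 0ℤ
signed-zero zero    = refl
signed-zero (suc k) = cong -_ (signed-zero k)

sumFin-signed-linear : ∀ {n m} (α : Fin m → ℤ) (X : Fin n → ℤ) (Y : Fin m → Fin n → ℤ) →
  (∀ j → X j ≡ sumFin (λ l → α l *ℤ Y l j)) →
  sumFin (λ j → signed (toℕ j) (X j)) ≡ sumFin (λ l → α l *ℤ sumFin (λ j → signed (toℕ j) (Y l j)))
sumFin-signed-linear α X Y X≡ = begin
  sumFin (λ j → signed (toℕ j) (X j))
    ≡⟨ sumFin-cong (λ j → trans (cong (signed (toℕ j)) (X≡ j))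
                                (signed-distrib-sumFin (toℕ j) (λ l → α l *ℤ Y l j))) ⟩
  sumFin (λ j → sumFin (λ l → signed (toℕ j) (α l *ℤ Y l j)))
    ≡⟨ sumFin-comm (λ j l → signed (toℕ j) (α l *ℤ Y l j)) ⟩
  sumFin (λ l → sumFin (λ j → signed (toℕ j) (α l *ℤ Y l j)))
    ≡⟨ sumFin-cong (λ l → trans (sumFin-cong (λ j → signed-distribʳ-* (toℕ j) (α l) (Y l j)))
                                (sym (*-distribˡ-sumFin (α l) (λ j → signed (toℕ j) (Y l j))))) ⟩
  sumFin (λ l → α l *ℤ sumFin (λ j → signed (toℕ j) (Y l j))) ∎
  where open ≡-Reasoning

minor : ∀ {n} → Mat (suc n) (suc n) → Fin (suc n) → Fin (suc n) → Mat n n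
minor N i j a b = N (punchIn i a) (punchIn j b)

det-cong : ∀ {n} {M N : Mat n n} → (∀ a b → M a b ≡ N a b) → det M ≡ det N
det-cong {zero}  M≗N = refl
det-cong {suc n} M≗N = sumFin-cong (λ j → cong (signed (toℕ j))
  (cong₂ _*ℤ_ (M≗N zero j) (det-cong (λ a b → M≗N (suc a) (punchIn j b)))))

signed-*-sumFin : ∀ {n} k x (w : Fin n → ℤ) →
  signed k (x *ℤ sumFin (λ i → signed (toℕ i) (w i)))
  ≡ sumFin (λ i → signed k (signed (toℕ i) (x *ℤ w i)))
signed-*-sumFin k x w = begin
  signed k (x *ℤ sumFin (λ i → signed (toℕ i) (w i)))
    ≡⟨ cong (signed k) (*-distribˡ-sumFin x (λ i → signed (toℕ i) (w i))) ⟩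
  signed k (sumFin (λ i → x *ℤ signed (toℕ i) (w i)))
    ≡⟨ signed-distrib-sumFin k (λ i → x *ℤ signed (toℕ i) (w i)) ⟩
  sumFin (λ i → signed k (x *ℤ signed (toℕ i) (w i)))
    ≡⟨ sumFin-cong (λ i → cong (signed k) (sym (signed-distribʳ-* (toℕ i) x (w i)))) ⟩
  sumFin (λ i → signed k (signed (toℕ i) (x *ℤ w i))) ∎
  where open ≡-Reasoning

det-firstColumn : ∀ {n} (N : Mat (suc n) (suc n)) →
  det N ≡ sumFin (λ i → signed (toℕ i) (N i zero *ℤ det (minor N i zero)))
det-firstColumn {zero}  N = refl
det-firstColumn {suc n} N = cong (N zero zero *ℤ det (minor N zero zero) +ℤ_) (begin
  sumFin (λ j → signed (suc (toℕ j)) (N zero (suc j) *ℤ det (minor N zero (suc j))))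
    ≡⟨ sumFin-cong (λ j → cong (λ d → signed (suc (toℕ j)) (N zero (suc j) *ℤ d))
                               (det-firstColumn (minor N zero (suc j)))) ⟩
  sumFin (λ j → signed (suc (toℕ j)) (N zero (suc j) *ℤ
    sumFin (λ i → signed (toℕ i) (N (suc i) zero *ℤ D i j))))
    ≡⟨ sumFin-cong (λ j → trans (signed-*-sumFin (suc (toℕ j)) (N zero (suc j)) (λ i → N (suc i) zero *ℤ D i j))
                                (sumFin-cong (λ i → reorder i j))) ⟩
  sumFin (λ j → sumFin (λ i → T i j))
    ≡⟨ sumFin-comm (λ j i → T i j) ⟩
  sumFin (λ i → sumFin (λ j → T i j))
    ≡⟨ sumFin-cong (λ i → signed-*-sumFin (suc (toℕ i)) (N (suc i) zero) (λ j → N zero (suc j) *ℤ D i j)) ⟨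
  sumFin (λ i → signed (suc (toℕ i)) (N (suc i) zero *ℤ det (minor N (suc i) zero))) ∎)
  where
  open ≡-Reasoning
  D : Fin (suc n) → Fin (suc n) → ℤ
  D i j = det (minor (minor N zero zero) i j)
  T : Fin (suc n) → Fin (suc n) → ℤ
  T i j = signed (suc (toℕ i)) (signed (toℕ j) (N (suc i) zero *ℤ (N zero (suc j) *ℤ D i j)))
  reorder : ∀ i j →
    signed (suc (toℕ j)) (signed (toℕ i) (N zero (suc j) *ℤ (N (suc i) zero *ℤ D i j))) ≡ T i j
  reorder i j = cong -_ (trans (signed-comm (toℕ j) (toℕ i) _)
    (cong (signed (toℕ i) ∘ signed (toℕ j)) (x∙yz≈y∙xz (N zero (suc j)) (N (suc i) zero) (D i j))))

det-transpose : ∀ {n} (N : Mat n n) → det (transpose N) ≡ det N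
det-transpose {zero}  N = refl
det-transpose {suc n} N = trans
  (sumFin-cong (λ j → cong (λ d → signed (toℕ j) (N j zero *ℤ d)) (det-transpose (minor N j zero))))
  (sym (det-firstColumn N))

swapRows₀₁ : ∀ {n m} → Mat (suc (suc n)) m → Mat (suc (suc n)) m
swapRows₀₁ N zero          = N (suc zero)
swapRows₀₁ N (suc zero)    = N zero
swapRows₀₁ N (suc (suc a)) = N (suc (suc a))

-- Expand along the first column: the terms of rows 0 and 1 trade places, and every
-- other minor gets its first two rows swapped.
mutual
  det-swapRows₀₁ : ∀ {n} (N : Mat (suc (suc n)) (suc (suc n))) → det (swapRows₀₁ N) ≡ - det N
  det-swapRows₀₁ N = begin
    det (swapRows₀₁ N)
      ≡⟨ det-firstColumn (swapRows₀₁ N) ⟩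
    N (suc zero) zero *ℤ det (minor (swapRows₀₁ N) zero zero)
      +ℤ (- (N zero zero *ℤ det (minor (swapRows₀₁ N) (suc zero) zero)) +ℤ R (swapRows₀₁ N))
      ≡⟨ cong₂ (λ d e → N (suc zero) zero *ℤ d +ℤ (- (N zero zero *ℤ e) +ℤ R (swapRows₀₁ N)))
               (det-cong minor₀) (det-cong minor₁) ⟩
    N (suc zero) zero *ℤ X₁ +ℤ (- (N zero zero *ℤ X₀) +ℤ R (swapRows₀₁ N))
      ≡⟨ cong (λ e → N (suc zero) zero *ℤ X₁ +ℤ (- (N zero zero *ℤ X₀) +ℤ e)) (swapRows₀₁-lowerTerms N) ⟩
    N (suc zero) zero *ℤ X₁ +ℤ (- (N zero zero *ℤ X₀) +ℤ - R N)
      ≡⟨ rearrange (N (suc zero) zero *ℤ X₁) (N zero zero *ℤ X₀) (R N) ⟩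
    - (N zero zero *ℤ X₀ +ℤ (- (N (suc zero) zero *ℤ X₁) +ℤ R N))
      ≡⟨ cong -_ (det-firstColumn N) ⟨
    - det N ∎
    where
    open ≡-Reasoning
    R : Mat _ _ → ℤ
    R P = sumFin (λ i → signed (toℕ (suc (suc i)))
                               (P (suc (suc i)) zero *ℤ det (minor P (suc (suc i)) zero)))
    X₀ = det (minor N zero zero)
    X₁ = det (minor N (suc zero) zero)
    minor₀ : ∀ a b → minor (swapRows₀₁ N) zero zero a b ≡ minor N (suc zero) zero a b
    minor₀ zero    b = refl
    minor₀ (suc a) b = refl
    minor₁ : ∀ a b → minor (swapRows₀₁ N) (suc zero) zero a b ≡ minor N zero zero a b
    minor₁ zero    b = refl
    minor₁ (suc a) b = refl
    rearrange : ∀ a b R → a +ℤ (- b +ℤ - R) ≡ - (b +ℤ (- a +ℤ R))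
    rearrange = solve-∀

  swapRows₀₁-lowerTerms : ∀ {n} (N : Mat (suc (suc n)) (suc (suc n))) →
    sumFin (λ i → signed (toℕ (suc (suc i)))
      (N (suc (suc i)) zero *ℤ det (minor (swapRows₀₁ N) (suc (suc i)) zero)))
    ≡ - sumFin (λ i → signed (toℕ (suc (suc i)))
                        (N (suc (suc i)) zero *ℤ det (minor N (suc (suc i)) zero)))
  swapRows₀₁-lowerTerms {zero}  N = refl
  swapRows₀₁-lowerTerms {suc n} N = trans (sumFin-cong term-negated) (sym (-‿distrib-sumFin term))
    where
    minor-swap : ∀ i a b → minor (swapRows₀₁ N) (suc (suc i)) zero a b
                         ≡ swapRows₀₁ (minor N (suc (suc i)) zero) a b
    minor-swap i zero          b = refl
    minor-swap i (suc zero)    b = refl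
    minor-swap i (suc (suc a)) b = refl
    term : Fin (suc n) → ℤ
    term i = signed (toℕ (suc (suc i))) (N (suc (suc i)) zero *ℤ det (minor N (suc (suc i)) zero))
    term-negated : ∀ i →
      signed (toℕ (suc (suc i))) (N (suc (suc i)) zero *ℤ det (minor (swapRows₀₁ N) (suc (suc i)) zero))
      ≡ - term i
    term-negated i = begin
      signed k (x *ℤ det (minor (swapRows₀₁ N) (suc (suc i)) zero))
        ≡⟨ cong (λ d → signed k (x *ℤ d))
                (trans (det-cong (minor-swap i)) (det-swapRows₀₁ (minor N (suc (suc i)) zero))) ⟩
      signed k (x *ℤ - det (minor N (suc (suc i)) zero))
        ≡⟨ cong (signed k) (ℤ.neg-distribʳ-* x _) ⟨
      signed k (- (x *ℤ det (minor N (suc (suc i)) zero)))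
        ≡⟨ signed-neg k _ ⟩
      - signed k (x *ℤ det (minor N (suc (suc i)) zero)) ∎
      where
      open ≡-Reasoning
      k = toℕ (suc (suc i))
      x = N (suc (suc i)) zero

i≡-i⇒i≡0 : ∀ {i} → i ≡ - i → i ≡ 0ℤ
i≡-i⇒i≡0 {+ zero}   _ = refl
i≡-i⇒i≡0 {+ suc n}  ()
i≡-i⇒i≡0 { -[1+ n ]} ()

det≡0-byFirstRowMinors : ∀ {n} (N : Mat (suc n) (suc n)) →
  (∀ j → det (minor N zero j) ≡ 0ℤ) → det N ≡ 0ℤ
det≡0-byFirstRowMinors N minors≡0 = sumFin-zero _ (λ j → begin
  signed (toℕ j) (N zero j *ℤ det (minor N zero j))
    ≡⟨ cong (λ d → signed (toℕ j) (N zero j *ℤ d)) (minors≡0 j) ⟩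
  signed (toℕ j) (N zero j *ℤ 0ℤ)
    ≡⟨ cong (signed (toℕ j)) (ℤ.*-zeroʳ (N zero j)) ⟩
  signed (toℕ j) 0ℤ
    ≡⟨ signed-zero (toℕ j) ⟩
  0ℤ ∎)
  where open ≡-Reasoning

-- Swapping rows 0 and 1 turns equal rows 0 and y+1 into equal rows 1 and y+1, and those
-- survive into every first-row minor.
det-equalRows₀ : ∀ {n} (N : Mat (suc n) (suc n)) y → (∀ b → N zero b ≡ N (suc y) b) → det N ≡ 0ℤ
det-equalRows₀ N zero N₀≗N₁ = i≡-i⇒i≡0 (trans (det-cong swap≗id) (det-swapRows₀₁ N))
  where
  swap≗id : ∀ a b → N a b ≡ swapRows₀₁ N a b
  swap≗id zero          b = N₀≗N₁ b
  swap≗id (suc zero)    b = sym (N₀≗N₁ b)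
  swap≗id (suc (suc a)) b = refl
det-equalRows₀ N (suc y) N₀≗Ny = ℤ.neg-injective (trans (sym (det-swapRows₀₁ N))
  (det≡0-byFirstRowMinors (swapRows₀₁ N) (λ j →
    det-equalRows₀ (minor (swapRows₀₁ N) zero j) y (N₀≗Ny ∘ punchIn j))))

det-equalRows : ∀ {n} (N : Mat n n) x y → x ≢ y → (∀ b → N x b ≡ N y b) → det N ≡ 0ℤ
det-equalRows N zero    zero    x≢y _     = contradiction refl x≢y
det-equalRows N zero    (suc y) _   Nx≗Ny = det-equalRows₀ N y Nx≗Ny
det-equalRows N (suc x) zero    _   Nx≗Ny = det-equalRows₀ N x (sym ∘ Nx≗Ny)
det-equalRows N (suc x) (suc y) x≢y Nx≗Ny =
  det≡0-byFirstRowMinors N (λ j → det-equalRows (minor N zero j) x y (x≢y ∘ cong suc) (Nx≗Ny ∘ punchIn j))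

setRow : ∀ {n m} → Mat n m → Fin n → (Fin m → ℤ) → Mat n m
setRow N k v = updateAt N k (const v)

setRow-reindexColumns : ∀ {n m m'} (N : Mat n m) (g : Fin m' → Fin m) k v a c →
  setRow N k v a (g c) ≡ setRow (λ a c → N a (g c)) k (v ∘ g) a c
setRow-reindexColumns N g zero    v zero    c = refl
setRow-reindexColumns N g zero    v (suc a) c = refl
setRow-reindexColumns N g (suc k) v zero    c = refl
setRow-reindexColumns N g (suc k) v (suc a) c = setRow-reindexColumns (N ∘ suc) g k v a c

det-setRow-suc : ∀ {n} (N : Mat (suc n) (suc n)) k v →
  det (setRow N (suc k) v)
  ≡ sumFin (λ j → signed (toℕ j) (N zero j *ℤ det (setRow (minor N zero j) k (v ∘ punchIn j))))
det-setRow-suc N k v = sumFin-cong (λ j →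
  cong (λ d → signed (toℕ j) (N zero j *ℤ d))
       (det-cong (setRow-reindexColumns (N ∘ suc) (punchIn j) k v)))

det-setRow-linear : ∀ {n m} (N : Mat n n) k (α : Fin m → ℤ) (u : Fin m → Fin n → ℤ) →
  det (setRow N k (λ b → sumFin (λ l → α l *ℤ u l b)))
  ≡ sumFin (λ l → α l *ℤ det (setRow N k (u l)))
det-setRow-linear {suc n} N zero α u = sumFin-signed-linear α _ (λ l j → u l j *ℤ det (minor N zero j))
  (λ j → trans (*-distribʳ-sumFin (det (minor N zero j)) (λ l → α l *ℤ u l j))
               (sumFin-cong (λ l → ℤ.*-assoc (α l) (u l j) _)))
det-setRow-linear {suc n} N (suc k) α u = begin
  det (setRow N (suc k) v)
    ≡⟨ det-setRow-suc N k v ⟩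
  sumFin (λ j → signed (toℕ j) (N zero j *ℤ det (setRow (minor N zero j) k (v ∘ punchIn j))))
    ≡⟨ sumFin-signed-linear α _ (λ l j → N zero j *ℤ E l j) (λ j → begin
         N zero j *ℤ det (setRow (minor N zero j) k (v ∘ punchIn j))
           ≡⟨ cong (N zero j *ℤ_) (det-setRow-linear (minor N zero j) k α (λ l → u l ∘ punchIn j)) ⟩
         N zero j *ℤ sumFin (λ l → α l *ℤ E l j)
           ≡⟨ *-distribˡ-sumFin (N zero j) (λ l → α l *ℤ E l j) ⟩
         sumFin (λ l → N zero j *ℤ (α l *ℤ E l j))
           ≡⟨ sumFin-cong (λ l → x∙yz≈y∙xz (N zero j) (α l) (E l j)) ⟩
         sumFin (λ l → α l *ℤ (N zero j *ℤ E l j)) ∎) ⟩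
  sumFin (λ l → α l *ℤ sumFin (λ j → signed (toℕ j) (N zero j *ℤ E l j)))
    ≡⟨ sumFin-cong (λ l → cong (α l *ℤ_) (det-setRow-suc N k (u l))) ⟨
  sumFin (λ l → α l *ℤ det (setRow N (suc k) (u l))) ∎
  where
  open ≡-Reasoning
  v = λ b → sumFin (λ l → α l *ℤ u l b)
  E : _ → Fin (suc n) → ℤ
  E l j = det (setRow (minor N zero j) k (u l ∘ punchIn j))

-- Cofactors and the adjugate

unit-diag : ∀ {n} (i : Fin n) → unit i i ≡ 1ℤ
unit-diag i with i ≟ i
... | yes _   = refl
... | no i≢i = contradiction refl i≢i

unit-off : ∀ {n} (i a : Fin n) → a ≢ i → unit i a ≡ 0ℤ
unit-off i a a≢i with a ≟ i
... | yes a≡i = contradiction a≡i a≢i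
... | no _    = refl

sumFin-*-unit : ∀ {n} (f : Fin n → ℤ) c → sumFin (λ l → f l *ℤ unit l c) ≡ f c
sumFin-*-unit f c = begin
  sumFin (λ l → f l *ℤ unit l c) ≡⟨ sumFin-single _ c (λ l l≢c →
                                      trans (cong (f l *ℤ_) (unit-off l c (l≢c ∘ sym))) (ℤ.*-zeroʳ (f l))) ⟩
  f c *ℤ unit c c                ≡⟨ cong (f c *ℤ_) (unit-diag c) ⟩
  f c *ℤ 1ℤ                      ≡⟨ ℤ.*-identityʳ (f c) ⟩
  f c                            ∎
  where open ≡-Reasoning

setRow-cong : ∀ {n m} (N : Mat n m) k {v w : Fin m → ℤ} → (∀ c → v c ≡ w c) →
  ∀ a b → setRow N k v a b ≡ setRow N k w a b
setRow-cong N zero    v≗w zero    b = v≗w b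
setRow-cong N zero    v≗w (suc a) b = refl
setRow-cong N (suc k) v≗w zero    b = refl
setRow-cong N (suc k) v≗w (suc a) b = setRow-cong (N ∘ suc) k v≗w a b

det-setRow-cofactors : ∀ {n} (N : Mat n n) k (w : Fin n → ℤ) →
  sumFin (λ l → w l *ℤ det (setRow N k (unit l))) ≡ det (setRow N k w)
det-setRow-cofactors N k w =
  trans (sym (det-setRow-linear N k w unit)) (det-cong (setRow-cong N k (sumFin-*-unit w)))

det-setRow-self : ∀ {n} (N : Mat n n) k → det (setRow N k (N k)) ≡ det N
det-setRow-self N k = det-cong (λ a → cong-app (updateAt-id-local k N refl a))

det-setRow-otherRow : ∀ {n} (N : Mat n n) {a k} → a ≢ k → det (setRow N k (N a)) ≡ 0ℤ
det-setRow-otherRow N {a} {k} a≢k = det-equalRows (setRow N k (N a)) a k a≢k (λ b →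
  trans (cong-app (updateAt-minimal a k N a≢k) b) (sym (cong-app (updateAt-updates k N) b)))

com≡det-setRow : ∀ {n} (N : Mat n n) i b → com N i b ≡ det (setRow (transpose N) b (unit i))
com≡det-setRow N i b = trans (sym (det-transpose (replaceCol N i b))) (det-cong entries)
  where
  entries : ∀ x y → replaceCol N i b y x ≡ setRow (transpose N) b (unit i) x y
  entries x y with x ≟ b
  ... | yes refl = sym (cong-app (updateAt-updates x (transpose N)) y)
  ... | no x≢b   = sym (cong-app (updateAt-minimal x b (transpose N) x≢b) y)

com-columnCofactors : ∀ {n} (N : Mat n n) a b →
  sumFin (λ i → N i a *ℤ com N i b) ≡ det (setRow (transpose N) b (transpose N a))
com-columnCofactors N a b = trans (sumFin-cong (λ i → cong (N i a *ℤ_) (com≡det-setRow N i b)))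
                                  (det-setRow-cofactors (transpose N) b (transpose N a))

com-columnExpansion : ∀ {n} (N : Mat n n) a → sumFin (λ i → N i a *ℤ com N i a) ≡ det N
com-columnExpansion N a =
  trans (com-columnCofactors N a a) (trans (det-setRow-self (transpose N) a) (det-transpose N))

com-otherColumnExpansion : ∀ {n} (N : Mat n n) {a b} → a ≢ b → sumFin (λ i → N i a *ℤ com N i b) ≡ 0ℤ
com-otherColumnExpansion N {a} {b} a≢b =
  trans (com-columnCofactors N a b) (det-setRow-otherRow (transpose N) a≢b)

-- Expand Σₐ com N a b · (N · rowCofactor)ₐ in both orders; det N ≢ 0 is only needed to cancel.
com≡rowCofactor : ∀ {n} (N : Mat n n) → det N ≢ 0ℤ → ∀ i b → com N i b ≡ det (setRow N i (unit b))
com≡rowCofactor N det≢0 i b = ℤ.*-cancelʳ-≡ _ _ (det N) {{≢-nonZero det≢0}} (begin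
  com N i b *ℤ det N
    ≡⟨ cong (com N i b *ℤ_) (det-setRow-self N i) ⟨
  com N i b *ℤ det (setRow N i (N i))
    ≡⟨ sumFin-single (λ a → com N a b *ℤ det (setRow N i (N a))) i (λ a a≢i →
         trans (cong (com N a b *ℤ_) (det-setRow-otherRow N a≢i)) (ℤ.*-zeroʳ (com N a b))) ⟨
  sumFin (λ a → com N a b *ℤ det (setRow N i (N a)))
    ≡⟨ sumFin-cong (λ a → cong (com N a b *ℤ_) (det-setRow-cofactors N i (N a))) ⟨
  sumFin (λ a → com N a b *ℤ (N *ᵥ rowCofactor) a)
    ≡⟨ ᵥ*-*ᵥ-assoc (λ a → com N a b) N rowCofactor ⟩
  sumFin (λ l → sumFin (λ a → com N a b *ℤ N a l) *ℤ rowCofactor l)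
    ≡⟨ sumFin-single _ b (λ l l≢b →
         trans (cong (_*ℤ rowCofactor l) (alien l≢b)) (ℤ.*-zeroˡ (rowCofactor l))) ⟩
  sumFin (λ a → com N a b *ℤ N a b) *ℤ rowCofactor b
    ≡⟨ cong (_*ℤ rowCofactor b) (trans (sumFin-cong (λ a → ℤ.*-comm (com N a b) (N a b)))
                                       (com-columnExpansion N b)) ⟩
  det N *ℤ rowCofactor b
    ≡⟨ ℤ.*-comm (det N) (rowCofactor b) ⟩
  rowCofactor b *ℤ det N ∎)
  where
  open ≡-Reasoning
  rowCofactor : Fin _ → ℤ
  rowCofactor l = det (setRow N i (unit l))
  alien : ∀ {l} → l ≢ b → sumFin (λ a → com N a b *ℤ N a l) ≡ 0ℤ
  alien l≢b = trans (sumFin-cong (λ a → ℤ.*-comm (com N a b) _)) (com-otherColumnExpansion N l≢b)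

com-rowCofactors : ∀ {n} (N : Mat n n) → det N ≢ 0ℤ → ∀ a i →
  sumFin (λ b → N a b *ℤ com N i b) ≡ det (setRow N i (N a))
com-rowCofactors N det≢0 a i = trans (sumFin-cong (λ b → cong (N a b *ℤ_) (com≡rowCofactor N det≢0 i b)))
                                     (det-setRow-cofactors N i (N a))

transpose-*ᵥ-com-*ᵥ : ∀ {n} (N : Mat n n) v a → (transpose N *ᵥ (com N *ᵥ v)) a ≡ det N *ℤ v a
transpose-*ᵥ-com-*ᵥ N v a = begin
  (transpose N *ᵥ (com N *ᵥ v)) a
    ≡⟨ ᵥ*-*ᵥ-assoc (transpose N a) (com N) v ⟩
  sumFin (λ l → (transpose N a ᵥ* com N) l *ℤ v l)
    ≡⟨ sumFin-single _ a (λ l l≢a → trans (cong (_*ℤ v l) (com-otherColumnExpansion N (l≢a ∘ sym)))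
                                          (ℤ.*-zeroˡ (v l))) ⟩
  (transpose N a ᵥ* com N) a *ℤ v a
    ≡⟨ cong (_*ℤ v a) (com-columnExpansion N a) ⟩
  det N *ℤ v a ∎
  where open ≡-Reasoning

*ᵥ-then-ᵥ*-com : ∀ {n} (N : Mat n n) y j → ((N *ᵥ y) ᵥ* com N) j ≡ y j *ℤ det N
*ᵥ-then-ᵥ*-com N y j = begin
  ((N *ᵥ y) ᵥ* com N) j
    ≡⟨ sumFin-cong (λ i → ℤ.*-comm ((N *ᵥ y) i) (com N i j)) ⟩
  sumFin (λ i → com N i j *ℤ (N *ᵥ y) i)
    ≡⟨ ᵥ*-*ᵥ-assoc (λ i → com N i j) N y ⟩
  sumFin (λ b → ((λ i → com N i j) ᵥ* N) b *ℤ y b)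
    ≡⟨ sumFin-single _ j (λ b b≢j → trans (cong (_*ℤ y b) (column b b≢j)) (ℤ.*-zeroˡ (y b))) ⟩
  ((λ i → com N i j) ᵥ* N) j *ℤ y j
    ≡⟨ cong (_*ℤ y j) (trans (sumFin-cong (λ i → ℤ.*-comm (com N i j) (N i j)))
                             (com-columnExpansion N j)) ⟩
  det N *ℤ y j
    ≡⟨ ℤ.*-comm (det N) (y j) ⟩
  y j *ℤ det N ∎
  where
  open ≡-Reasoning
  column : ∀ b → b ≢ j → ((λ i → com N i j) ᵥ* N) b ≡ 0ℤ
  column b b≢j = trans (sumFin-cong (λ i → ℤ.*-comm (com N i j) (N i b))) (com-otherColumnExpansion N b≢j)

ᵥ*-com-then-*ᵥ : ∀ {n} (N : Mat n n) → det N ≢ 0ℤ → ∀ v a → (N *ᵥ (v ᵥ* com N)) a ≡ v a *ℤ det N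
ᵥ*-com-then-*ᵥ N det≢0 v a = begin
  (N *ᵥ (v ᵥ* com N)) a
    ≡⟨ sumFin-cong (λ b → ℤ.*-comm (N a b) ((v ᵥ* com N) b)) ⟩
  sumFin (λ b → (v ᵥ* com N) b *ℤ N a b)
    ≡⟨ ᵥ*-*ᵥ-assoc v (com N) (N a) ⟨
  sumFin (λ i → v i *ℤ (com N *ᵥ N a) i)
    ≡⟨ sumFin-cong (λ i → cong (v i *ℤ_) (row i)) ⟩
  sumFin (λ i → v i *ℤ det (setRow N i (N a)))
    ≡⟨ sumFin-single _ a (λ i i≢a →
         trans (cong (v i *ℤ_) (det-setRow-otherRow N (i≢a ∘ sym))) (ℤ.*-zeroʳ (v i))) ⟩
  v a *ℤ det (setRow N a (N a))
    ≡⟨ cong (v a *ℤ_) (det-setRow-self N a) ⟩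
  v a *ℤ det N ∎
  where
  open ≡-Reasoning
  row : ∀ i → (com N *ᵥ N a) i ≡ det (setRow N i (N a))
  row i = trans (sumFin-cong (λ b → ℤ.*-comm (com N i b) (N a b))) (com-rowCofactors N det≢0 a i)

-- Replace the first row by det A times itself minus the combination c of the other rows:
-- this multiplies det S by det A and, as Aᵀ (com A β) = det A · β, leaves only the corner entry.
det-bordered : ∀ {n} (S : Mat (suc n) (suc n)) → det (minor S zero zero) ≢ 0ℤ →
  det S ≡ det (minor S zero zero) *ℤ S zero zero
          - sumFin (λ i → S (suc i) zero *ℤ (com (minor S zero zero) *ᵥ (λ b → S zero (suc b))) i)
det-bordered {n} S detA≢0 = ℤ.*-cancelˡ-≡ (det A) _ _ {{≢-nonZero detA≢0}} (begin
  det A *ℤ det S                        ≡⟨ eliminated-linear ⟨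
  det (setRow S zero eliminated)        ≡⟨ eliminated-expand ⟩
  det A *ℤ eliminated zero              ≡⟨ cong (det A *ℤ_) eliminated-corner ⟩
  det A *ℤ (det A *ℤ S zero zero - sumFin (λ i → S (suc i) zero *ℤ c i)) ∎)
  where
  open ≡-Reasoning
  A = minor S zero zero
  c : Fin n → ℤ
  c = com A *ᵥ (λ b → S zero (suc b))
  α : Fin (suc n) → ℤ
  α zero    = det A
  α (suc i) = - c i
  eliminated : Fin (suc n) → ℤ
  eliminated b = sumFin (λ l → α l *ℤ S l b)

  eliminated-linear : det (setRow S zero eliminated) ≡ det A *ℤ det S
  eliminated-linear = begin
    det (setRow S zero eliminated)
      ≡⟨ det-setRow-linear S zero α S ⟩
    det A *ℤ det (setRow S zero (S zero)) +ℤ sumFin (λ i → - c i *ℤ det (setRow S zero (S (suc i))))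
      ≡⟨ cong₂ _+ℤ_ (cong (det A *ℤ_) (det-setRow-self S zero))
                    (sumFin-zero _ (λ i → trans (cong (- c i *ℤ_) (det-setRow-otherRow S {suc i} {zero} (λ ())))
                                                (ℤ.*-zeroʳ (- c i)))) ⟩
    det A *ℤ det S +ℤ 0ℤ
      ≡⟨ ℤ.+-identityʳ _ ⟩
    det A *ℤ det S ∎

  eliminated-off : ∀ b → eliminated (suc b) ≡ 0ℤ
  eliminated-off b = begin
    det A *ℤ S zero (suc b) +ℤ sumFin (λ i → - c i *ℤ A i b)
      ≡⟨ cong (det A *ℤ S zero (suc b) +ℤ_) (begin
           sumFin (λ i → - c i *ℤ A i b)   ≡⟨ sumFin-cong (λ i → trans (sym (ℤ.neg-distribˡ-* (c i) (A i b)))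
                                                                        (cong -_ (ℤ.*-comm (c i) (A i b)))) ⟩
           sumFin (λ i → - (A i b *ℤ c i)) ≡⟨ -‿distrib-sumFin (λ i → A i b *ℤ c i) ⟨
           - (transpose A *ᵥ c) b          ≡⟨ cong -_ (transpose-*ᵥ-com-*ᵥ A (λ b → S zero (suc b)) b) ⟩
           - (det A *ℤ S zero (suc b))     ∎) ⟩
    det A *ℤ S zero (suc b) +ℤ - (det A *ℤ S zero (suc b))
      ≡⟨ ℤ.+-inverseʳ (det A *ℤ S zero (suc b)) ⟩
    0ℤ ∎

  eliminated-expand : det (setRow S zero eliminated) ≡ det A *ℤ eliminated zero
  eliminated-expand = begin
    eliminated zero *ℤ det A
      +ℤ sumFin (λ j → signed (toℕ (suc j)) (eliminated (suc j) *ℤ det (minor S zero (suc j))))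
      ≡⟨ cong (eliminated zero *ℤ det A +ℤ_) (sumFin-zero _ (λ j → begin
           signed (suc (toℕ j)) (eliminated (suc j) *ℤ det (minor S zero (suc j)))
             ≡⟨ cong (λ e → signed (suc (toℕ j)) (e *ℤ det (minor S zero (suc j)))) (eliminated-off j) ⟩
           signed (suc (toℕ j)) (0ℤ *ℤ det (minor S zero (suc j)))
             ≡⟨ signed-zero (suc (toℕ j)) ⟩
           0ℤ ∎)) ⟩
    eliminated zero *ℤ det A +ℤ 0ℤ
      ≡⟨ trans (ℤ.+-identityʳ _) (ℤ.*-comm (eliminated zero) (det A)) ⟩
    det A *ℤ eliminated zero ∎

  eliminated-corner : eliminated zero ≡ det A *ℤ S zero zero - sumFin (λ i → S (suc i) zero *ℤ c i)
  eliminated-corner = cong (det A *ℤ S zero zero +ℤ_) (begin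
    sumFin (λ i → - c i *ℤ S (suc i) zero)   ≡⟨ sumFin-cong (λ i → trans (sym (ℤ.neg-distribˡ-* (c i) _))
                                                                          (cong -_ (ℤ.*-comm (c i) _))) ⟩
    sumFin (λ i → - (S (suc i) zero *ℤ c i)) ≡⟨ -‿distrib-sumFin (λ i → S (suc i) zero *ℤ c i) ⟨
    - sumFin (λ i → S (suc i) zero *ℤ c i)   ∎)

-- Lattices

↑ˡ≢↑ʳ : ∀ {r s} (i : Fin r) (p : Fin s) → i ↑ˡ s ≢ r ↑ʳ p
↑ˡ≢↑ʳ {r} {s} i p eq with trans (sym (splitAt-↑ˡ r i s)) (trans (cong (splitAt r) eq) (splitAt-↑ʳ r s p))
... | ()

data Join (r t : ℕ) : Fin (r + t) → Set where
  left  : ∀ i → Join r t (i ↑ˡ t)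
  right : ∀ j → Join r t (r ↑ʳ j)

join-view : ∀ r t q → Join r t q
join-view zero    t q       = right q
join-view (suc r) t zero    = left zero
join-view (suc r) t (suc q) with join-view r t q
... | left i  = left (suc i)
... | right j = right j

∷-↑ˡ-injective : ∀ {r s} (p : Fin s) → Injective _≡_ _≡_ ((r ↑ʳ p) ∷ (_↑ˡ s))
∷-↑ˡ-injective p {zero}  {zero}  _  = refl
∷-↑ˡ-injective p {zero}  {suc b} eq = contradiction (sym eq) (↑ˡ≢↑ʳ b p)
∷-↑ˡ-injective p {suc a} {zero}  eq = contradiction eq (↑ˡ≢↑ʳ a p)
∷-↑ˡ-injective {s = s} p {suc a} {suc b} eq = cong suc (↑ˡ-injective s a b eq)

unimodular-*ᵥ-surjective : ∀ {n} {U : Mat n n} → Unimodular U → ∀ z → ∃ λ w → ∀ a → (U *ᵥ w) a ≡ z a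
unimodular-*ᵥ-surjective {U = U} unimodular z = (λ b → (z ᵥ* com U) b *ℤ det U) , λ a → begin
  (U *ᵥ (λ b → (z ᵥ* com U) b *ℤ det U)) a ≡⟨ *ᵥ-*ʳ U (z ᵥ* com U) (det U) a ⟩
  (U *ᵥ (z ᵥ* com U)) a *ℤ det U         ≡⟨ cong (_*ℤ det U) (ᵥ*-com-then-*ᵥ U detU≢0 z a) ⟩
  z a *ℤ det U *ℤ det U                   ≡⟨ ℤ.*-assoc (z a) (det U) (det U) ⟩
  z a *ℤ (det U *ℤ det U)                 ≡⟨ cong (z a *ℤ_) detU² ⟩
  z a *ℤ 1ℤ                               ≡⟨ ℤ.*-identityʳ (z a) ⟩
  z a                                     ∎
  where
  open ≡-Reasoning
  detU² : det U *ℤ det U ≡ 1ℤ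
  detU² = [ (λ detU≡1 → cong₂ _*ℤ_ detU≡1 detU≡1) , (λ detU≡-1 → cong₂ _*ℤ_ detU≡-1 detU≡-1) ]′ unimodular
  detU≢0 : det U ≢ 0ℤ
  detU≢0 detU≡0 with trans (sym detU²) (cong (_*ℤ det U) detU≡0)
  ... | ()

hnf-*ᵥ : ∀ {r t} {M : Mat r (r + t)} {H : Mat r r} {U : Mat (r + t) (r + t)} → IsHNF M H U →
  ∀ w a → (M *ᵥ (U *ᵥ w)) a ≡ (H *ᵥ (λ b → w (b ↑ˡ t))) a
hnf-*ᵥ {r} {t} {M} {H} {U} (_ , left≡H , right≡0 , _) w a = begin
  (M *ᵥ (U *ᵥ w)) a
    ≡⟨ ᵥ*-*ᵥ-assoc (M a) U w ⟩
  sumFin (λ l → (M ⊗ U) a l *ℤ w l)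
    ≡⟨ sumFin-↑ r (λ l → (M ⊗ U) a l *ℤ w l) ⟩
  sumFin (λ b → (M ⊗ U) a (b ↑ˡ t) *ℤ w (b ↑ˡ t)) +ℤ sumFin (λ j → (M ⊗ U) a (r ↑ʳ j) *ℤ w (r ↑ʳ j))
    ≡⟨ cong₂ _+ℤ_ (sumFin-cong (λ b → cong (_*ℤ w (b ↑ˡ t)) (left≡H a b)))
                  (sumFin-zero _ (λ j → trans (cong (_*ℤ w (r ↑ʳ j)) (right≡0 a j))
                                              (ℤ.*-zeroˡ (w (r ↑ʳ j))))) ⟩
  (H *ᵥ (λ b → w (b ↑ˡ t))) a +ℤ 0ℤ
    ≡⟨ ℤ.+-identityʳ _ ⟩
  (H *ᵥ (λ b → w (b ↑ˡ t))) a ∎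
  where open ≡-Reasoning

inImage⇒divisible : ∀ {n} (H : Mat n n) {v y : Fin n → ℤ} → (∀ a → v a ≡ (H *ᵥ y) a) →
  ∀ j → det H ∣ (v ᵥ* com H) j
inImage⇒divisible H {v} {y} v≡Hy j = ∣⇒∣ᵤ (Signed.divides (y j)
  (trans (sumFin-cong (λ i → cong (_*ℤ com H i j) (v≡Hy i))) (*ᵥ-then-ᵥ*-com H y j)))

divisible⇒inImage : ∀ {n} (H : Mat n n) → det H ≢ 0ℤ → ∀ {v : Fin n → ℤ} →
  (∀ j → det H ∣ (v ᵥ* com H) j) → ∃ λ y → ∀ a → v a ≡ (H *ᵥ y) a
divisible⇒inImage H detH≢0 {v} divisible = y , λ a →
  ℤ.*-cancelʳ-≡ _ _ (det H) {{≢-nonZero detH≢0}} (begin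
    v a *ℤ det H
      ≡⟨ ᵥ*-com-then-*ᵥ H detH≢0 v a ⟨
    (H *ᵥ (v ᵥ* com H)) a
      ≡⟨ sumFin-cong (λ j → cong (H a j *ℤ_) (Signed._∣_.equality (quotient j))) ⟩
    (H *ᵥ (λ j → y j *ℤ det H)) a
      ≡⟨ *ᵥ-*ʳ H y (det H) a ⟩
    (H *ᵥ y) a *ℤ det H ∎)
  where
  open ≡-Reasoning
  quotient : ∀ j → det H Signed.∣ (v ᵥ* com H) j
  quotient j = ∣ᵤ⇒∣ (divisible j)
  y : Fin _ → ℤ
  y j = Signed._∣_.quotient (quotient j)

module Blocks {r s t : ℕ} (L : Mat (r + s) (r + t)) where

  A : Mat r r
  A a b = L (a ↑ˡ s) (b ↑ˡ t)

  B : Mat s r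
  B a b = L (r ↑ʳ a) (b ↑ˡ t)

  M : Mat r (r + t)
  M a = L (a ↑ˡ s)

  C : Mat r s
  C = com A ⊗ transpose B

  top : (Fin (r + s) → ℤ) → Fin r → ℤ
  top x i = x (i ↑ˡ s)

  bottomRow-combination : HasRank L r → det A ≢ 0ℤ → ∀ p q →
    det A *ℤ L (r ↑ʳ p) q ≡ sumFin (λ i → L (i ↑ˡ s) q *ℤ C i p)
  bottomRow-combination rank detA≢0 p q with join-view r t q
  ... | left b  = sym (transpose-*ᵥ-com-*ᵥ A (B p) b)
  ... | right j = ℤ.i-j≡0⇒i≡j _ _ (trans (sym (det-bordered S detA≢0)) detS≡0)
    where
    S : Mat (suc r) (suc r)
    S = submatrix L ((r ↑ʳ p) ∷ (_↑ˡ s)) ((r ↑ʳ j) ∷ (_↑ˡ t))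
    detS≡0 : det S ≡ 0ℤ
    detS≡0 = proj₂ rank _ _ (∷-↑ˡ-injective p) (∷-↑ˡ-injective j)

  bottom-combination-*ᵥ : HasRank L r → det A ≢ 0ℤ →
    ∀ z p → det A *ℤ (L *ᵥ z) (r ↑ʳ p) ≡ (top (L *ᵥ z) ᵥ* C) p
  bottom-combination-*ᵥ rank detA≢0 z p = begin
    det A *ℤ (L *ᵥ z) (r ↑ʳ p)
      ≡⟨ *-distribˡ-sumFin (det A) (λ q → L (r ↑ʳ p) q *ℤ z q) ⟩
    sumFin (λ q → det A *ℤ (L (r ↑ʳ p) q *ℤ z q))
      ≡⟨ sumFin-cong (λ q → trans (sym (ℤ.*-assoc (det A) _ (z q)))
                                  (cong (_*ℤ z q) (bottomRow-combination rank detA≢0 p q))) ⟩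
    sumFin (λ q → sumFin (λ i → L (i ↑ˡ s) q *ℤ C i p) *ℤ z q)
      ≡⟨ sumFin-cong (λ q → cong (_*ℤ z q) (sumFin-cong (λ i → ℤ.*-comm (L (i ↑ˡ s) q) (C i p)))) ⟩
    sumFin (λ q → ((λ i → C i p) ᵥ* M) q *ℤ z q)
      ≡⟨ ᵥ*-*ᵥ-assoc (λ i → C i p) M z ⟨
    sumFin (λ i → C i p *ℤ top (L *ᵥ z) i)
      ≡⟨ sumFin-cong (λ i → ℤ.*-comm (C i p) (top (L *ᵥ z) i)) ⟩
    (top (L *ᵥ z) ᵥ* C) p ∎
    where open ≡-Reasoning

  inLattice⇒bottom : HasRank L r → det A ≢ 0ℤ → ∀ {x} → InLattice L x →
    ∀ p → det A *ℤ x (r ↑ʳ p) ≡ (top x ᵥ* C) p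
  inLattice⇒bottom rank detA≢0 {x} (c , x≡Lc) p = begin
    det A *ℤ x (r ↑ʳ p)          ≡⟨ cong (det A *ℤ_) (x≡Lc (r ↑ʳ p)) ⟩
    det A *ℤ (L *ᵥ c) (r ↑ʳ p)   ≡⟨ bottom-combination-*ᵥ rank detA≢0 c p ⟩
    (top (L *ᵥ c) ᵥ* C) p        ≡⟨ sumFin-cong (λ i → cong (_*ℤ C i p) (x≡Lc (i ↑ˡ s))) ⟨
    (top x ᵥ* C) p               ∎
    where open ≡-Reasoning

  module _ {H : Mat r r} {U : Mat (r + t) (r + t)} (hnf : IsHNF M H U) where

    inLattice⇒top-inImage : ∀ {x} → InLattice L x → ∃ λ y → ∀ a → top x a ≡ (H *ᵥ y) a
    inLattice⇒top-inImage {x} (c , x≡Lc) with unimodular-*ᵥ-surjective (proj₁ hnf) c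
    ... | w , Uw≡c = (λ b → w (b ↑ˡ t)) , λ a → begin
      x (a ↑ˡ s)          ≡⟨ x≡Lc (a ↑ˡ s) ⟩
      (M *ᵥ c) a          ≡⟨ sumFin-cong (λ q → cong (M a q *ℤ_) (Uw≡c q)) ⟨
      (M *ᵥ (U *ᵥ w)) a   ≡⟨ hnf-*ᵥ {M = M} {H} {U} hnf w a ⟩
      (H *ᵥ (λ b → w (b ↑ˡ t))) a ∎
      where open ≡-Reasoning

    top-inImage⇒inLattice : HasRank L r → det A ≢ 0ℤ → ∀ {x} (y : Fin r → ℤ) →
      (∀ a → top x a ≡ (H *ᵥ y) a) → (∀ p → det A *ℤ x (r ↑ʳ p) ≡ (top x ᵥ* C) p) → InLattice L x
    top-inImage⇒inLattice rank detA≢0 {x} y x≡Hy bottom = c , entry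
      where
      c = U *ᵥ (y ++ const 0ℤ)
      top≡ : ∀ a → top x a ≡ (L *ᵥ c) (a ↑ˡ s)
      top≡ a = trans (x≡Hy a) (sym (trans (hnf-*ᵥ {M = M} {H} {U} hnf (y ++ const 0ℤ) a)
                                          (sumFin-cong (λ b → cong (H a b *ℤ_) (lookup-++ˡ y (const 0ℤ) b)))))
      entry : ∀ i → x i ≡ (L *ᵥ c) i
      entry i with join-view r s i
      ... | left a  = top≡ a
      ... | right p = ℤ.*-cancelˡ-≡ (det A) _ _ {{≢-nonZero detA≢0}} (begin
        det A *ℤ x (r ↑ʳ p)           ≡⟨ bottom p ⟩
        (top x ᵥ* C) p                ≡⟨ sumFin-cong (λ i → cong (_*ℤ C i p) (top≡ i)) ⟩
        (top (L *ᵥ c) ᵥ* C) p         ≡⟨ bottom-combination-*ᵥ rank detA≢0 c p ⟨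
        det A *ℤ (L *ᵥ c) (r ↑ʳ p)    ∎)
        where open ≡-Reasoning


lemma2 : (r s t : ℕ) (L : Mat (r + s) (r + t)) →
  let A  : Mat r r
      A  = λ a b → L (a ↑ˡ s) (b ↑ˡ t)
      A' : Mat r t
      A' = λ a b → L (a ↑ˡ s) (r ↑ʳ b)
      B  : Mat s r
      B  = λ a b → L (r ↑ʳ a) (b ↑ˡ t)
      M  : Mat r (r + t)
      M  = λ a b → L (a ↑ˡ s) b
  in HasRank L r → det A ≢ 0ℤ →
     (H : Mat r r) (U : Mat (r + t) (r + t)) → IsHNF M H U →
     (x : Fin (r + s) → ℤ) →
     InLattice L x ⇔
       ((∀ (j : Fin r) → det H ∣ sumFin (λ i → x (i ↑ˡ s) *ℤ com H i j))
       × (∀ (j : Fin s) → det A *ℤ x (r ↑ʳ j)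
             ≡ sumFin (λ i → x (i ↑ˡ s) *ℤ (com A ⊗ transpose B) i j)))
lemma2 r s t L rank detA≢0 H U hnf x = mk⇔
  (λ x∈L → let (y , top≡Hy) = inLattice⇒top-inImage hnf x∈L
           in inImage⇒divisible H top≡Hy , inLattice⇒bottom rank detA≢0 x∈L)
  (λ (divisible , bottom) → let (y , top≡Hy) = divisible⇒inImage H detH≢0 divisible
                            in top-inImage⇒inLattice hnf rank detA≢0 y top≡Hy bottom)
  where
  open Blocks {r} {s} {t} L
  detH≢0 : det H ≢ 0ℤ
  detH≢0 = proj₁ (proj₂ (proj₂ (proj₂ hnf)))
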